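{- Let $G=(V_G,E_G)$ be a graph with a colouring $f_G:V_G\to[k]$, let $H=(V_H,E_H)$ be a graph with $V_H\cap V_G=\emptyset$, and let $U\subseteq V_H$ with $|U|=k$ induce a clique in $H$. Let $\widetilde{G}=\mathcal{C}(G,f_G,H,U)$ (built with any admissible bijection $f_H$) with colouring $f_{\widetilde{G}}$, and let $X$ be a colourful subset of $\widetilde{G}$ with respect to $f_{\widetilde{G}}$. Then the subgraph $\widetilde{G}[X]$ is isomorphic either to $H$ or to a graph obtainable from $H$ by deleting one or more edges of $H[U]$. Moreover, the number of edges deleted is equal to the number of non-edges (pairs of distinct non-adjacent vertices) in $\widetilde{G}[X\cap V_G]$.
   Context: Construction $\mathcal{C}(G,f_G,H,U)$: let $f_H:V_H\to[|V_H|]$ be any bijection with $f_H(u)\in[k]$ for all $u\in U$ (an admissible choice), and let $V_H'=V_H\setminus U$. The graph $\mathcal{C}(G,f_G,H,U)$ has vertex set $V_G\cup V_H'$ and edge set $E_G\cup E_1\cup E_2$, where $E_1=\{uv\in E_H: u,v\in V_H'\}$ and $E_2=\{vw: v\in V_G,\ w\in V_H',\ \exists u\in U \text{ with } uw\in E_H \text{ and } f_H(u)=f_G(v)\}$. Its colouring $f_{\mathcal{C}}:V_G\cup V_H'\to[|V_H|]$ is $f_H(v)$ for $v\in V_H'$ and $f_G(v)$ for $v\in V_G$. A vertex subset $X$ is colourful with respect to a colouring with colour set $[m]$ if for every $i\in[m]$ exactly one vertex of $X$ has colour $i$. -}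

module Defs where

open import Data.Bool using (Bool; true; false; T; not; _∧_; if_then_else_)
open import Data.Nat using (ℕ; _<ᵇ_)
open import Data.Fin using (Fin; toℕ)
open import Data.Fin.Subset using (Subset; _∈_; ∣_∣)
open import Data.Vec using (lookup)
open import Data.List using (List; map; allFin)
open import Data.Nat.ListAction using (sum)
open import Data.Product using (Σ; ∃; ∃!; _×_; _,_; proj₁; proj₂)
open import Data.Sum using (_⊎_; inj₁; inj₂)
open import Relation.Binary.PropositionalEquality using (_≡_; _≢_)

record Graph (n : ℕ) : Set where
  field
    adj    : Fin n → Fin n → Bool
    sym    : ∀ i j → adj i j ≡ adj j i
    irrefl : ∀ i → adj i i ≡ false
open Graph public

IsClique : {n : ℕ} → Graph n → Subset n → Set
IsClique H U = ∀ u v → u ∈ U → v ∈ U → u ≢ v → T (adj H u v)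

VH' : {n : ℕ} → Subset n → Set
VH' {n} U = Σ (Fin n) (λ w → T (not (lookup U w)))

-- vertex set V_G ∪ V_H' of C(G,f_G,H,U)  (V_G and V_H are disjoint)
CVert : (nG : ℕ) {nH : ℕ} → Subset nH → Set
CVert nG U = Fin nG ⊎ VH' U

CAdj : {nG nH k : ℕ} (G : Graph nG) (fG : Fin nG → Fin k)
       (H : Graph nH) (U : Subset nH) (fH : Fin nH → Fin nH) →
       CVert nG U → CVert nG U → Set
CAdj G fG H U fH (inj₁ v) (inj₁ w) = T (adj G v w)
CAdj G fG H U fH (inj₂ (a , _)) (inj₂ (b , _)) = T (adj H a b)
CAdj G fG H U fH (inj₁ v) (inj₂ (w , _)) =
  ∃ λ u → u ∈ U × T (adj H u w) × toℕ (fH u) ≡ toℕ (fG v)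
CAdj G fG H U fH (inj₂ (w , _)) (inj₁ v) =
  ∃ λ u → u ∈ U × T (adj H u w) × toℕ (fH u) ≡ toℕ (fG v)

-- the colouring f_C (colour values as natural numbers; they lie in [|V_H|])
CColour : {nG nH k : ℕ} (fG : Fin nG → Fin k) (U : Subset nH)
          (fH : Fin nH → Fin nH) → CVert nG U → ℕ
CColour fG U fH (inj₁ v) = toℕ (fG v)
CColour fG U fH (inj₂ (w , _)) = toℕ (fH w)

Colourful : {V : Set} (m : ℕ) (col : V → ℕ) (X : V → Bool) → Set
Colourful {V} m col X =
  (i : Fin m) → ∃! _≡_ (λ (x : V) → T (X x) × col x ≡ toℕ i)

-- number of unordered pairs {i,j}, i ≠ j, with P i j (P assumed symmetric)
countPairs : (n : ℕ) → (Fin n → Fin n → Bool) → ℕ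
countPairs n P =
  sum (map (λ i → sum (map (λ j → if (toℕ i <ᵇ toℕ j) ∧ P i j then 1 else 0)
                           (allFin n)))
           (allFin n))

-- number of non-edges (pairs of distinct non-adjacent vertices) of
-- C(G,f_G,H,U)[X ∩ V_G]; on V_G the edges of C(G,f_G,H,U) are exactly E_G
nonEdgesOnVG : {nG nH : ℕ} (G : Graph nG) (U : Subset nH)
               (X : CVert nG U → Bool) → ℕ
nonEdgesOnVG {nG} G U X =
  countPairs nG (λ v w → X (inj₁ v) ∧ X (inj₁ w) ∧ not (adj G v w))

module Submission where

-- Colourfulness makes x ↦ f_H⁻¹(f_C(x)) a bijection φ from X onto V_H. It fixes the vertices of
-- X ∩ V_H', and it sends X ∩ V_G into U: f_H maps the k vertices of U injectively into [k], so by
-- counting every vertex of H whose colour is below k lies in U. Under φ the edges E_1 and E_2 become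
-- exactly the edges of H with an end outside U, while E_G restricted to X ∩ V_G lands inside the
-- clique U. Hence G̃[X] is H with those edges ab of H[U] deleted whose preimages are non-adjacent in G,
-- and φ puts the deleted edges in bijection with the non-edges of G̃[X ∩ V_G].

open import Defs renaming (sym to adj-sym)
open import Data.Bool using (Bool; true; false; T; not; _∧_; if_then_else_)
open import Data.Bool.Properties
  using (T-∧; T-≡; T-not-≡; T-irrelevant; ∧-identityʳ; ∧-zeroʳ; not-involutive)
open import Data.Nat using (ℕ; zero; suc; _+_; _*_; _≤_; _<_; _<ᵇ_; z≤n; s≤s)
open import Data.Nat.Properties
  using (≤-refl; +-mono-≤; +-mono-<-≤; +-mono-≤-<; +-identityʳ; +-cancelʳ-≡; *-cancelˡ-≡;
         <-irrefl; <-≤-trans; <-cmp; <ᵇ⇒<; <⇒<ᵇ; +-0-commutativeMonoid)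
open import Data.Nat.ListAction using () renaming (sum to sumᴸ)
open import Data.List using (map; allFin; tabulate)
open import Data.List.Properties using (map-tabulate)
open import Data.Fin using (Fin; zero; suc; toℕ; fromℕ<)
open import Data.Fin.Properties using (_≟_; toℕ-injective; toℕ<n; toℕ-fromℕ<)
open import Data.Fin.Permutation using (Permutation; _⟨$⟩ʳ_; _⟨$⟩ˡ_; inverseʳ)
open import Data.Fin.Subset using (Subset; _∈_; ∣_∣)
open import Data.Fin.Subset.Properties using (∣p∣≤n)
open import Data.Vec using ([]; _∷_; lookup)
open import Data.Vec.Properties using ([]=⇒lookup; lookup⇒[]=)
open import Data.Product using (Σ; ∃; _×_; _,_; proj₁; proj₂)
open import Data.Sum using (inj₁; inj₂)
open import Data.Sum.Properties using (inj₁-injective)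
open import Data.Empty using (⊥-elim)
open import Function using (_∘_; _$_; id)
open import Function.Bundles using (_⤖_; Bijection; _⇔_; mk⤖; mk⇔; Equivalence)
open import Function.Definitions using (Bijective)
open import Function.Properties.Bijection using (⤖⇒↔)
open import Relation.Binary.Definitions using (tri<; tri≈; tri>)
open import Relation.Binary.PropositionalEquality hiding ([_])
open import Relation.Nullary using (¬_; Dec; does; yes; no; contradiction)
open import Relation.Nullary.Decidable using (does-⇔; dec-true; dec-false; T?)
open import Algebra.Properties.CommutativeMonoid.Sum +-0-commutativeMonoid
  using (sum-syntax; ∑-comm; ∑-distrib-+; ∑-permute; sum-cong-≗; sum-replicate-zero)

T-injective : ∀ {a b} → T a ⇔ T b → a ≡ b
T-injective {a} {b} a⇔b = does-⇔ a⇔b (T? a) (T? b)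

T⇒≡true : ∀ {b} → T b → b ≡ true
T⇒≡true = Equivalence.to T-≡

¬T⇒≡false : ∀ {b} → ¬ T b → b ≡ false
¬T⇒≡false = dec-false (T? _)

does⇒ : ∀ {P : Set} (P? : Dec P) → T (does P?) → P
does⇒ (yes p) _ = p

⇒does : ∀ {P : Set} (P? : Dec P) → P → T (does P?)
⇒does (yes _) _ = _
⇒does (no ¬p) p = ¬p p

𝟙 : Bool → ℕ
𝟙 b = if b then 1 else 0

𝟙-mono-≤ : ∀ {a b} → (T a → T b) → 𝟙 a ≤ 𝟙 b
𝟙-mono-≤ {false} _ = z≤n
𝟙-mono-≤ {true} {false} a⇒b = ⊥-elim (a⇒b _)
𝟙-mono-≤ {true} {true} _ = ≤-refl

∈⇒T : ∀ {n a} {U : Subset n} → a ∈ U → T (lookup U a)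
∈⇒T a∈U = Equivalence.from T-≡ ([]=⇒lookup a∈U)

T⇒∈ : ∀ {n a} {U : Subset n} → T (lookup U a) → a ∈ U
T⇒∈ {U = U} Ua = lookup⇒[]= _ U (Equivalence.to T-≡ Ua)

∑-zero : ∀ n → ∑[ i < n ] 0 ≡ 0
∑-zero = sum-replicate-zero

∑-mono-≤ : ∀ {n} {f g : Fin n → ℕ} → (∀ i → f i ≤ g i) → ∑[ i < n ] f i ≤ ∑[ i < n ] g i
∑-mono-≤ {zero} f≤g = z≤n
∑-mono-≤ {suc n} f≤g = +-mono-≤ (f≤g zero) (∑-mono-≤ (f≤g ∘ suc))

∑-mono-< : ∀ {n} {f g : Fin n → ℕ} → (∀ i → f i ≤ g i) → ∀ i → f i < g i →
           ∑[ i < n ] f i < ∑[ i < n ] g i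
∑-mono-< f≤g zero fi<gi = +-mono-<-≤ fi<gi (∑-mono-≤ (f≤g ∘ suc))
∑-mono-< f≤g (suc i) fi<gi = +-mono-≤-< (f≤g zero) (∑-mono-< (f≤g ∘ suc) i fi<gi)

∑-delta : ∀ {n} i (g : Fin n → ℕ) → ∑[ j < n ] (if does (i ≟ j) then g j else 0) ≡ g i
∑-delta {suc n} zero g = trans (cong (g zero +_) (∑-zero n)) (+-identityʳ (g zero))
∑-delta {suc n} (suc i) g = ∑-delta i (g ∘ suc)

sumᴸ-allFin : ∀ n (f : Fin n → ℕ) → sumᴸ (map f (allFin n)) ≡ ∑[ i < n ] f i
sumᴸ-allFin n f = trans (cong sumᴸ (map-tabulate id f)) (sumᴸ-tabulate n f)
  where
  sumᴸ-tabulate : ∀ n (f : Fin n → ℕ) → sumᴸ (tabulate f) ≡ ∑[ i < n ] f i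
  sumᴸ-tabulate zero f = refl
  sumᴸ-tabulate (suc n) f = cong (f zero +_) (sumᴸ-tabulate n (f ∘ suc))

sumOver : ∀ {n} → (Fin n → Bool) → (Fin n → ℕ) → ℕ
sumOver {n} B F = ∑[ a < n ] (if B a then F a else 0)

sumOver-cong : ∀ {n} (B : Fin n → Bool) {F G : Fin n → ℕ} → (∀ a → T (B a) → F a ≡ G a) →
               sumOver B F ≡ sumOver B G
sumOver-cong B {F} {G} F≡G = sum-cong-≗ pointwise
  where
  pointwise : ∀ a → (if B a then F a else 0) ≡ (if B a then G a else 0)
  pointwise a with B a in Ba
  ... | true  = F≡G a (subst T (sym Ba) _)
  ... | false = refl

sumOver-supported : ∀ {n} (B : Fin n → Bool) {F : Fin n → ℕ} → (∀ a → ¬ T (B a) → F a ≡ 0) →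
                    sumOver B F ≡ ∑[ a < n ] F a
sumOver-supported B {F} vanish = sum-cong-≗ pointwise
  where
  pointwise : ∀ a → (if B a then F a else 0) ≡ F a
  pointwise a with B a in Ba
  ... | true  = refl
  ... | false = sym (vanish a (subst T Ba))

record SubsetBijection {m n} (A : Fin m → Bool) (B : Fin n → Bool) : Set where
  field
    to         : Fin m → Fin n
    to-∈       : ∀ {v} → T (A v) → T (B (to v))
    injective  : ∀ {v w} → T (A v) → T (A w) → to v ≡ to w → v ≡ w
    surjective : ∀ {a} → T (B a) → ∃ λ v → T (A v) × to v ≡ a

∑-reindex : ∀ {m n} {A : Fin m → Bool} {B : Fin n → Bool} (π : SubsetBijection A B) (F : Fin n → ℕ) →
            sumOver A (F ∘ SubsetBijection.to π) ≡ sumOver B F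
∑-reindex {m} {n} {A} {B} π F = begin
  ∑[ v < m ] (if A v then F (to v) else 0) ≡⟨ sum-cong-≗ expand ⟩
  ∑[ v < m ] ∑[ a < n ] δ v a              ≡⟨ ∑-comm δ ⟩
  ∑[ a < n ] ∑[ v < m ] δ v a              ≡⟨ sum-cong-≗ collapse ⟩
  ∑[ a < n ] (if B a then F a else 0)      ∎
  where
  open ≡-Reasoning
  open SubsetBijection π

  δ : Fin m → Fin n → ℕ
  δ v a = if A v ∧ does (to v ≟ a) then F a else 0

  expand : ∀ v → (if A v then F (to v) else 0) ≡ ∑[ a < n ] δ v a
  expand v with A v
  ... | true  = sym (∑-delta (to v) F)
  ... | false = sym (∑-zero n)

  collapse : ∀ a → ∑[ v < m ] δ v a ≡ (if B a then F a else 0)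
  collapse a with B a in Ba
  ... | true  = trans (sum-cong-≗ (cong (λ b → if b then F a else 0) ∘ onlyPreimage))
                      (∑-delta v₀ (λ _ → F a))
    where
    preimage : ∃ λ v → T (A v) × to v ≡ a
    preimage = surjective (subst T (sym Ba) _)
    v₀ = proj₁ preimage
    Av₀ = proj₁ (proj₂ preimage)
    v₀↦a = proj₂ (proj₂ preimage)

    onlyPreimage : ∀ v → A v ∧ does (to v ≟ a) ≡ does (v₀ ≟ v)
    onlyPreimage v = T-injective (mk⇔ only if)
      where
      only : T (A v ∧ does (to v ≟ a)) → T (does (v₀ ≟ v))
      only p with Av , v↦a ← Equivalence.to T-∧ p =
        ⇒does (v₀ ≟ v) (sym (injective Av Av₀ (trans (does⇒ (to v ≟ a) v↦a) (sym v₀↦a))))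
      if : T (does (v₀ ≟ v)) → T (A v ∧ does (to v ≟ a))
      if q with refl ← does⇒ (v₀ ≟ v) q = Equivalence.from T-∧ (Av₀ , ⇒does (to v₀ ≟ a) v₀↦a)
  ... | false = trans (sum-cong-≗ (cong (λ b → if b then F a else 0) ∘ noPreimage)) (∑-zero m)
    where
    noPreimage : ∀ v → A v ∧ does (to v ≟ a) ≡ false
    noPreimage v = ¬T⇒≡false λ p → let Av , v↦a = Equivalence.to T-∧ p in
      subst T Ba (subst (T ∘ B) (does⇒ (to v ≟ a) v↦a) (to-∈ Av))

-- Counting and the pigeonhole principle

count : ∀ n → (Fin n → Bool) → ℕ
count n P = ∑[ i < n ] 𝟙 (P i)

∣p∣≡count : ∀ {n} (p : Subset n) → ∣ p ∣ ≡ count n (lookup p)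
∣p∣≡count []          = refl
∣p∣≡count (true ∷ p)  = cong suc (∣p∣≡count p)
∣p∣≡count (false ∷ p) = ∣p∣≡count p

count-<ᵇ : ∀ {n k} → k ≤ n → count n (λ i → toℕ i <ᵇ k) ≡ k
count-<ᵇ {n} {zero} _ = ∑-zero n
count-<ᵇ {suc n} {suc k} (s≤s k≤n) = cong suc (count-<ᵇ k≤n)

count-permute : ∀ {n} (π : Permutation n n) (P : Fin n → Bool) → count n (P ∘ (π ⟨$⟩ʳ_)) ≡ count n P
count-permute π P = sym (∑-permute (𝟙 ∘ P) π)

count-⊂ : ∀ {n} {P Q : Fin n → Bool} → (∀ i → T (P i) → T (Q i)) →
          ∀ i → T (Q i) → ¬ T (P i) → count n P < count n Q
count-⊂ {P = P} {Q} P⊆Q i Qi ¬Pi = ∑-mono-< (λ j → 𝟙-mono-≤ (P⊆Q j)) i 𝟙Pi<𝟙Qi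
  where
  𝟙Pi<𝟙Qi : 𝟙 (P i) < 𝟙 (Q i)
  𝟙Pi<𝟙Qi rewrite ¬T⇒≡false ¬Pi | T⇒≡true Qi = s≤s z≤n

image<k⇒∈ : ∀ {n k} {U : Subset n} {f : Fin n → Fin n} → Bijective _≡_ _≡_ f → ∣ U ∣ ≡ k →
            (∀ u → u ∈ U → toℕ (f u) < k) → ∀ a → toℕ (f a) < k → a ∈ U
image<k⇒∈ {n} {k} {U} {f} f-bijective ∣U∣≡k f[U]<k a fa<k with T? (lookup U a)
... | yes Ua  = T⇒∈ Ua
... | no ¬Ua =
  contradiction (count-⊂ U⊆f⁻¹[k] a (<⇒<ᵇ fa<k) ¬Ua) (<-irrefl (trans count-U (sym count-f⁻¹[k])))
  where
  U⊆f⁻¹[k] : ∀ b → T (lookup U b) → T (toℕ (f b) <ᵇ k)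
  U⊆f⁻¹[k] b Ub = <⇒<ᵇ (f[U]<k b (T⇒∈ Ub))
  count-U : count n (lookup U) ≡ k
  count-U = trans (sym (∣p∣≡count U)) ∣U∣≡k
  count-f⁻¹[k] : count n (λ b → toℕ (f b) <ᵇ k) ≡ k
  count-f⁻¹[k] = trans (count-permute (⤖⇒↔ (mk⤖ f-bijective)) (λ i → toℕ i <ᵇ k))
                       (count-<ᵇ (subst (_≤ n) ∣U∣≡k (∣p∣≤n U)))

-- Unordered pairs

orderedPairs diagonal : ∀ n → (Fin n → Fin n → Bool) → ℕ
orderedPairs n P = ∑[ i < n ] ∑[ j < n ] 𝟙 (P i j)
diagonal n P = ∑[ i < n ] 𝟙 (P i i)

countPairs≡∑ : ∀ n P → countPairs n P ≡ ∑[ i < n ] ∑[ j < n ] 𝟙 ((toℕ i <ᵇ toℕ j) ∧ P i j)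
countPairs≡∑ n P =
  trans (sumᴸ-allFin n _) (sum-cong-≗ λ i → sumᴸ-allFin n λ j → 𝟙 ((toℕ i <ᵇ toℕ j) ∧ P i j))

orderedPairs≡2*countPairs+diagonal : ∀ n (P : Fin n → Fin n → Bool) → (∀ i j → P i j ≡ P j i) →
                                      orderedPairs n P ≡ 2 * countPairs n P + diagonal n P
orderedPairs≡2*countPairs+diagonal n P P-sym = begin
  orderedPairs n P
    ≡⟨ sum-cong-≗ (λ i → sum-cong-≗ (split i)) ⟩
  ∑[ i < n ] ∑[ j < n ] (above i j + below i j + onDiag i j)
    ≡⟨ sum-cong-≗ (λ i → ∑-distrib-+₃ (above i) (below i) (onDiag i)) ⟩
  ∑[ i < n ] (∑[ j < n ] above i j + ∑[ j < n ] below i j + ∑[ j < n ] onDiag i j)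
    ≡⟨ ∑-distrib-+₃ {n} _ _ _ ⟩
  c + ∑[ i < n ] ∑[ j < n ] below i j + ∑[ i < n ] ∑[ j < n ] onDiag i j
    ≡⟨ cong₂ (λ x y → c + x + y) (∑-comm below) (sum-cong-≗ λ i → ∑-delta i (𝟙 ∘ P i)) ⟩
  c + c + diagonal n P
    ≡⟨ cong (λ x → c + x + diagonal n P) (+-identityʳ c) ⟨
  2 * c + diagonal n P
    ≡⟨ cong (λ x → 2 * x + diagonal n P) (countPairs≡∑ n P) ⟨
  2 * countPairs n P + diagonal n P
    ∎
  where
  open ≡-Reasoning
  above below onDiag : Fin n → Fin n → ℕ
  above i j  = 𝟙 ((toℕ i <ᵇ toℕ j) ∧ P i j)
  below i j  = above j i
  onDiag i j = if does (i ≟ j) then 𝟙 (P i j) else 0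
  c = ∑[ i < n ] ∑[ j < n ] above i j

  ∑-distrib-+₃ : ∀ {m} (f g h : Fin m → ℕ) →
                 ∑[ i < m ] (f i + g i + h i) ≡ ∑[ i < m ] f i + ∑[ i < m ] g i + ∑[ i < m ] h i
  ∑-distrib-+₃ f g h = trans (∑-distrib-+ _ h) (cong (_+ _) (∑-distrib-+ f g))

  split : ∀ i j → 𝟙 (P i j) ≡ above i j + below i j + onDiag i j
  split i j with <-cmp (toℕ i) (toℕ j)
  ... | tri< i<j i≢j j≮i
    rewrite T⇒≡true (<⇒<ᵇ i<j) | ¬T⇒≡false (j≮i ∘ <ᵇ⇒< _ _)
          | dec-false (i ≟ j) (i≢j ∘ cong toℕ)
    = sym (trans (+-identityʳ _) (+-identityʳ _))
  ... | tri> i≮j i≢j j<i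
    rewrite ¬T⇒≡false (i≮j ∘ <ᵇ⇒< _ _) | T⇒≡true (<⇒<ᵇ j<i)
          | dec-false (i ≟ j) (i≢j ∘ cong toℕ)
    = trans (cong 𝟙 (P-sym i j)) (sym (+-identityʳ _))
  ... | tri≈ i≮i i≡j _ with refl ← toℕ-injective i≡j
    rewrite ¬T⇒≡false (i≮i ∘ <ᵇ⇒< _ _) | dec-true (i ≟ i) refl
    = refl

countPairs-cong-offDiagonal : ∀ n {P P′ : Fin n → Fin n → Bool} →
                              (∀ i j → i ≢ j → P i j ≡ P′ i j) → countPairs n P ≡ countPairs n P′
countPairs-cong-offDiagonal n {P} {P′} P≡P′ = begin
  countPairs n P
    ≡⟨ countPairs≡∑ n P ⟩
  ∑[ i < n ] ∑[ j < n ] 𝟙 ((toℕ i <ᵇ toℕ j) ∧ P i j)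
    ≡⟨ sum-cong-≗ (λ i → sum-cong-≗ (pointwise i)) ⟩
  ∑[ i < n ] ∑[ j < n ] 𝟙 ((toℕ i <ᵇ toℕ j) ∧ P′ i j)
    ≡⟨ countPairs≡∑ n P′ ⟨
  countPairs n P′
    ∎
  where
  open ≡-Reasoning
  pointwise : ∀ i j → 𝟙 ((toℕ i <ᵇ toℕ j) ∧ P i j) ≡ 𝟙 ((toℕ i <ᵇ toℕ j) ∧ P′ i j)
  pointwise i j with toℕ i <ᵇ toℕ j in i<j
  ... | false = refl
  ... | true  = cong 𝟙 (P≡P′ i j λ { refl → <-irrefl refl (<ᵇ⇒< (toℕ i) _ (subst T (sym i<j) _)) })

module _ {n} {B : Fin n → Bool} {P : Fin n → Fin n → Bool}
         (P-supported : ∀ a b → T (P a b) → T (B a)) where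

  private
    vanishes : ∀ a → ¬ T (B a) → ∀ b → 𝟙 (P a b) ≡ 0
    vanishes a ¬Ba b = cong 𝟙 (¬T⇒≡false (¬Ba ∘ P-supported a b))

  diagonal-supported : diagonal n P ≡ sumOver B (λ a → 𝟙 (P a a))
  diagonal-supported = sym (sumOver-supported B λ a ¬Ba → vanishes a ¬Ba a)

  orderedPairs-supported : (∀ a b → P a b ≡ P b a) →
                           orderedPairs n P ≡ sumOver B (λ a → sumOver B (λ b → 𝟙 (P a b)))
  orderedPairs-supported P-sym = begin
    ∑[ a < n ] ∑[ b < n ] 𝟙 (P a b)
      ≡⟨ sumOver-supported B rowVanishes ⟨
    sumOver B (λ a → ∑[ b < n ] 𝟙 (P a b))
      ≡⟨ sumOver-cong B (λ a _ → sumOver-supported B (columnVanishes a)) ⟨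
    sumOver B (λ a → sumOver B (λ b → 𝟙 (P a b)))
      ∎
    where
    open ≡-Reasoning
    rowVanishes : ∀ a → ¬ T (B a) → ∑[ b < n ] 𝟙 (P a b) ≡ 0
    rowVanishes a ¬Ba = trans (sum-cong-≗ (vanishes a ¬Ba)) (∑-zero n)
    columnVanishes : ∀ a b → ¬ T (B b) → 𝟙 (P a b) ≡ 0
    columnVanishes a b ¬Bb = trans (cong 𝟙 (P-sym a b)) (vanishes b ¬Bb a)

-- Reindexing does not respect the order i < j used by countPairs, so the transport goes through the
-- order-free counts orderedPairs and diagonal, which determine countPairs of a symmetric relation.
module _ {m n} {A : Fin m → Bool} {B : Fin n → Bool} (π : SubsetBijection A B)
         {P : Fin n → Fin n → Bool} {Q : Fin m → Fin m → Bool}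
         (P-sym : ∀ a b → P a b ≡ P b a) (Q-sym : ∀ v w → Q v w ≡ Q w v)
         (P-supported : ∀ a b → T (P a b) → T (B a))
         (Q-supported : ∀ v w → T (Q v w) → T (A v))
         (P∘π≡Q : ∀ {v w} → T (A v) → T (A w) →
                  P (SubsetBijection.to π v) (SubsetBijection.to π w) ≡ Q v w) where
  open SubsetBijection π

  diagonal-transport : diagonal n P ≡ diagonal m Q
  diagonal-transport = begin
    diagonal n P                          ≡⟨ diagonal-supported P-supported ⟩
    sumOver B (λ a → 𝟙 (P a a))           ≡⟨ ∑-reindex π (λ a → 𝟙 (P a a)) ⟨
    sumOver A (λ v → 𝟙 (P (to v) (to v))) ≡⟨ sumOver-cong A (λ v Av → cong 𝟙 (P∘π≡Q Av Av)) ⟩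
    sumOver A (λ v → 𝟙 (Q v v))           ≡⟨ diagonal-supported Q-supported ⟨
    diagonal m Q                          ∎
    where open ≡-Reasoning

  orderedPairs-transport : orderedPairs n P ≡ orderedPairs m Q
  orderedPairs-transport = begin
    orderedPairs n P
      ≡⟨ orderedPairs-supported P-supported P-sym ⟩
    sumOver B (λ a → sumOver B (λ b → 𝟙 (P a b)))
      ≡⟨ sumOver-cong B (λ a _ → ∑-reindex π (𝟙 ∘ P a)) ⟨
    sumOver B (λ a → sumOver A (λ w → 𝟙 (P a (to w))))
      ≡⟨ ∑-reindex π _ ⟨
    sumOver A (λ v → sumOver A (λ w → 𝟙 (P (to v) (to w))))
      ≡⟨ sumOver-cong A (λ v Av → sumOver-cong A λ w Aw → cong 𝟙 (P∘π≡Q Av Aw)) ⟩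
    sumOver A (λ v → sumOver A (λ w → 𝟙 (Q v w)))
      ≡⟨ orderedPairs-supported Q-supported Q-sym ⟨
    orderedPairs m Q
      ∎
    where open ≡-Reasoning

  countPairs-transport : countPairs n P ≡ countPairs m Q
  countPairs-transport = *-cancelˡ-≡ _ _ 2 (+-cancelʳ-≡ (diagonal m Q) _ _ (begin
    2 * countPairs n P + diagonal m Q   ≡⟨ cong (2 * countPairs n P +_) diagonal-transport ⟨
    2 * countPairs n P + diagonal n P   ≡⟨ orderedPairs≡2*countPairs+diagonal n P P-sym ⟨
    orderedPairs n P                    ≡⟨ orderedPairs-transport ⟩
    orderedPairs m Q                    ≡⟨ orderedPairs≡2*countPairs+diagonal m Q Q-sym ⟩
    2 * countPairs m Q + diagonal m Q   ∎))
    where open ≡-Reasoning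

-- The colourful subgraph

module ColourfulSubgraph
  {nG nH k : ℕ} (G : Graph nG) (fG : Fin nG → Fin k) (H : Graph nH) (U : Subset nH)
  (∣U∣≡k : ∣ U ∣ ≡ k) (U-clique : IsClique H U)
  (fH : Fin nH → Fin nH) (fH-bijective : Bijective _≡_ _≡_ fH)
  (fH[U]<k : ∀ u → u ∈ U → toℕ (fH u) < k)
  (X : CVert nG U → Bool) (X-colourful : Colourful nH (CColour fG U fH) X)
  where

  V : Set
  V = CVert nG U

  colour : V → ℕ
  colour = CColour fG U fH

  fH↔ : Permutation nH nH
  fH↔ = ⤖⇒↔ (mk⤖ fH-bijective)

  fH-injective : ∀ {a b} → fH a ≡ fH b → a ≡ b
  fH-injective = proj₁ fH-bijective

  colour<nH : ∀ x → colour x < nH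
  colour<nH (inj₁ v)       = <-≤-trans (toℕ<n (fG v)) (subst (_≤ nH) ∣U∣≡k (∣p∣≤n U))
  colour<nH (inj₂ (w , _)) = toℕ<n (fH w)

  toH : V → Fin nH
  toH x = fH↔ ⟨$⟩ˡ fromℕ< (colour<nH x)

  fH∘toH : ∀ x → toℕ (fH (toH x)) ≡ colour x
  fH∘toH x = trans (cong toℕ (inverseʳ fH↔)) (toℕ-fromℕ< _)

  toH-inj₂ : ∀ w w∉U → toH (inj₂ (w , w∉U)) ≡ w
  toH-inj₂ w w∉U = fH-injective (toℕ-injective (fH∘toH (inj₂ (w , w∉U))))

  toH-inj₁∈U : ∀ v → toH (inj₁ v) ∈ U
  toH-inj₁∈U v = image<k⇒∈ fH-bijective ∣U∣≡k fH[U]<k _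
                   (subst (_< k) (sym (fH∘toH (inj₁ v))) (toℕ<n (fG v)))

  fromH : Fin nH → V
  fromH a = proj₁ (X-colourful (fH a))

  fromH∈X : ∀ a → T (X (fromH a))
  fromH∈X a = proj₁ (proj₁ (proj₂ (X-colourful (fH a))))

  colour-fromH : ∀ a → colour (fromH a) ≡ toℕ (fH a)
  colour-fromH a = proj₂ (proj₁ (proj₂ (X-colourful (fH a))))

  fromH-toH : ∀ {x} → T (X x) → fromH (toH x) ≡ x
  fromH-toH {x} x∈X = proj₂ (proj₂ (X-colourful (fH (toH x)))) (x∈X , sym (fH∘toH x))

  toH-fromH : ∀ a → toH (fromH a) ≡ a
  toH-fromH a = fH-injective (toℕ-injective (trans (fH∘toH (fromH a)) (colour-fromH a)))

  toH-injective : ∀ {x y} → T (X x) → T (X y) → toH x ≡ toH y → x ≡ y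
  toH-injective x∈X y∈X e = trans (sym (fromH-toH x∈X)) (trans (cong fromH e) (fromH-toH y∈X))

  φ : Σ V (T ∘ X) ⤖ Fin nH
  φ = mk⤖ {to = toH ∘ proj₁} (injective , λ a → (fromH a , fromH∈X a) , λ { refl → toH-fromH a })
    where
    injective : ∀ {x y : Σ V (T ∘ X)} → toH (proj₁ x) ≡ toH (proj₁ y) → x ≡ y
    injective {x , x∈X} {y , y∈X} e with refl ← toH-injective x∈X y∈X e =
      cong (x ,_) (T-irrelevant x∈X y∈X)

  nonAdjacentInG : V → V → Bool
  nonAdjacentInG (inj₁ v) (inj₁ w) = not (adj G v w)
  nonAdjacentInG _        _        = false

  nonAdjacentInG-sym : ∀ x y → nonAdjacentInG x y ≡ nonAdjacentInG y x
  nonAdjacentInG-sym (inj₁ v) (inj₁ w) = cong not (adj-sym G v w)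
  nonAdjacentInG-sym (inj₁ v) (inj₂ _) = refl
  nonAdjacentInG-sym (inj₂ _) (inj₁ w) = refl
  nonAdjacentInG-sym (inj₂ _) (inj₂ _) = refl

  nonAdjacentInG⇒toH∈U : ∀ x y → T (nonAdjacentInG x y) → toH x ∈ U
  nonAdjacentInG⇒toH∈U (inj₁ v) (inj₁ w) _ = toH-inj₁∈U v

  missing : Fin nH → Fin nH → Bool
  missing a b = nonAdjacentInG (fromH a) (fromH b)

  missing-sym : ∀ a b → missing a b ≡ missing b a
  missing-sym a b = nonAdjacentInG-sym (fromH a) (fromH b)

  missing⇒∈U : ∀ a b → T (missing a b) → a ∈ U
  missing⇒∈U a b m = subst (_∈ U) (toH-fromH a) (nonAdjacentInG⇒toH∈U (fromH a) (fromH b) m)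

  -- The conjunct adj H a b only rules out the diagonal: missing a a holds whenever fromH a ∈ V_G.
  deleted : Fin nH → Fin nH → Bool
  deleted a b = adj H a b ∧ missing a b

  deleted-sym : ∀ a b → deleted a b ≡ deleted b a
  deleted-sym a b = cong₂ _∧_ (adj-sym H a b) (missing-sym a b)

  deleted⇒U-edge : ∀ a b → T (deleted a b) → a ∈ U × b ∈ U × T (adj H a b)
  deleted⇒U-edge a b d with adjH , m ← Equivalence.to T-∧ d =
    missing⇒∈U a b m , missing⇒∈U b a (subst T (missing-sym a b) m) , adjH

  remaining : Fin nH → Fin nH → Bool
  remaining a b = adj H a b ∧ not (deleted a b)

  ∉U⇒¬∈U : ∀ {w} → T (not (lookup U w)) → ¬ w ∈ U
  ∉U⇒¬∈U w∉U w∈U = subst T (Equivalence.to T-not-≡ w∉U) (∈⇒T w∈U)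

  remaining-outsideʳ : ∀ a {w} → T (not (lookup U w)) → remaining a w ≡ adj H a w
  remaining-outsideʳ a {w} w∉U
    rewrite ¬T⇒≡false {deleted a w} (∉U⇒¬∈U w∉U ∘ proj₁ ∘ proj₂ ∘ deleted⇒U-edge a w) =
      ∧-identityʳ (adj H a w)

  remaining-outsideˡ : ∀ a {w} → T (not (lookup U w)) → remaining w a ≡ adj H w a
  remaining-outsideˡ a {w} w∉U
    rewrite ¬T⇒≡false {deleted w a} (∉U⇒¬∈U w∉U ∘ proj₁ ∘ deleted⇒U-edge w a) =
      ∧-identityʳ (adj H w a)

  remaining-inj₁ : ∀ {v w} → T (X (inj₁ v)) → T (X (inj₁ w)) →
                   remaining (toH (inj₁ v)) (toH (inj₁ w))
                     ≡ adj H (toH (inj₁ v)) (toH (inj₁ w)) ∧ adj G v w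
  remaining-inj₁ {v} {w} v∈X w∈X
    rewrite fromH-toH v∈X | fromH-toH w∈X with adj H (toH (inj₁ v)) (toH (inj₁ w))
  ... | true  = not-involutive (adj G v w)
  ... | false = refl

  edge-VG-VH′ : ∀ v w → (∃ λ u → u ∈ U × T (adj H u w) × toℕ (fH u) ≡ toℕ (fG v))
                        ⇔ T (adj H (toH (inj₁ v)) w)
  edge-VG-VH′ v w = mk⇔ (λ (u , _ , uw , fHu≡fGv) → subst (λ u → T (adj H u w)) (u≡toH fHu≡fGv) uw)
                        (λ e → toH (inj₁ v) , toH-inj₁∈U v , e , fH∘toH (inj₁ v))
    where
    u≡toH : ∀ {u} → toℕ (fH u) ≡ toℕ (fG v) → u ≡ toH (inj₁ v)
    u≡toH e = fH-injective (toℕ-injective (trans e (sym (fH∘toH (inj₁ v)))))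

  adj-G⇒adj-H : ∀ {v w} → T (X (inj₁ v)) → T (X (inj₁ w)) →
                T (adj G v w) → T (adj H (toH (inj₁ v)) (toH (inj₁ w)))
  adj-G⇒adj-H {v} {w} v∈X w∈X vw = U-clique _ _ (toH-inj₁∈U v) (toH-inj₁∈U w) toH-v≢toH-w
    where
    toH-v≢toH-w : toH (inj₁ v) ≢ toH (inj₁ w)
    toH-v≢toH-w e with refl ← toH-injective v∈X w∈X e = subst T (irrefl G v) vw

  φ-adjacency : ∀ (x y : Σ V (T ∘ X)) →
                CAdj G fG H U fH (proj₁ x) (proj₁ y) ⇔ T (remaining (toH (proj₁ x)) (toH (proj₁ y)))
  φ-adjacency (inj₁ v , v∈X) (inj₁ w , w∈X) =
    subst (λ b → T (adj G v w) ⇔ T b) (sym (remaining-inj₁ v∈X w∈X)) $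
      mk⇔ (λ vw → Equivalence.from T-∧ (adj-G⇒adj-H v∈X w∈X vw , vw)) (proj₂ ∘ Equivalence.to T-∧)
  φ-adjacency (inj₁ v , _) (inj₂ (w , w∉U) , _)
    rewrite toH-inj₂ w w∉U | remaining-outsideʳ (toH (inj₁ v)) w∉U = edge-VG-VH′ v w
  φ-adjacency (inj₂ (w , w∉U) , _) (inj₁ v , _)
    rewrite toH-inj₂ w w∉U | remaining-outsideˡ (toH (inj₁ v)) w∉U | adj-sym H w (toH (inj₁ v)) =
      edge-VG-VH′ v w
  φ-adjacency (inj₂ (a , a∉U) , _) (inj₂ (b , b∉U) , _)
    rewrite toH-inj₂ a a∉U | toH-inj₂ b b∉U | remaining-outsideʳ a b∉U = mk⇔ id id

  VG∩X↔U : SubsetBijection (λ v → X (inj₁ v)) (lookup U)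
  VG∩X↔U = record
    { to         = λ v → toH (inj₁ v)
    ; to-∈       = λ {v} _ → ∈⇒T (toH-inj₁∈U v)
    ; injective  = λ v∈X w∈X → inj₁-injective ∘ toH-injective v∈X w∈X
    ; surjective = surjective
    }
    where
    surjective : ∀ {a} → T (lookup U a) → ∃ λ v → T (X (inj₁ v)) × toH (inj₁ v) ≡ a
    surjective {a} Ua with fromH a in fromH-a
    ... | inj₁ v = v , subst (T ∘ X) fromH-a (fromH∈X a) , trans (cong toH (sym fromH-a)) (toH-fromH a)
    ... | inj₂ (w , w∉U) = contradiction (T⇒∈ Ua) (subst (λ b → ¬ b ∈ U) w≡a (∉U⇒¬∈U w∉U))
      where
      w≡a : w ≡ a
      w≡a = trans (sym (toH-inj₂ w w∉U)) (trans (cong toH (sym fromH-a)) (toH-fromH a))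

  nonEdgeInG : Fin nG → Fin nG → Bool
  nonEdgeInG v w = X (inj₁ v) ∧ X (inj₁ w) ∧ not (adj G v w)

  nonEdgeInG-sym : ∀ v w → nonEdgeInG v w ≡ nonEdgeInG w v
  nonEdgeInG-sym v w rewrite adj-sym G v w with X (inj₁ v) | X (inj₁ w)
  ... | true  | true  = refl
  ... | true  | false = refl
  ... | false | true  = refl
  ... | false | false = refl

  missing∘toH : ∀ {v w} → T (X (inj₁ v)) → T (X (inj₁ w)) →
                missing (toH (inj₁ v)) (toH (inj₁ w)) ≡ nonEdgeInG v w
  missing∘toH v∈X w∈X rewrite fromH-toH v∈X | fromH-toH w∈X | T⇒≡true v∈X | T⇒≡true w∈X = refl

  deleted≡missing-offDiagonal : ∀ a b → a ≢ b → deleted a b ≡ missing a b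
  deleted≡missing-offDiagonal a b a≢b with missing a b in m
  ... | false = ∧-zeroʳ (adj H a b)
  ... | true  = trans (∧-identityʳ (adj H a b)) (T⇒≡true adjH)
    where
    m′ : T (missing a b)
    m′ = subst T (sym m) _
    adjH : T (adj H a b)
    adjH = U-clique a b (missing⇒∈U a b m′) (missing⇒∈U b a (subst T (missing-sym a b) m′)) a≢b

  deletedCount : countPairs nH deleted ≡ nonEdgesOnVG G U X
  deletedCount = begin
    countPairs nH deleted ≡⟨ countPairs-cong-offDiagonal nH deleted≡missing-offDiagonal ⟩
    countPairs nH missing ≡⟨ countPairs-transport VG∩X↔U missing-sym nonEdgeInG-sym
                               (λ a b → ∈⇒T ∘ missing⇒∈U a b) (λ _ _ → proj₁ ∘ Equivalence.to T-∧) missing∘toH ⟩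
    countPairs nG nonEdgeInG ∎
    where open ≡-Reasoning

mainTheorem6 :
    (nG nH k : ℕ) (G : Graph nG) (fG : Fin nG → Fin k)
    (H : Graph nH) (U : Subset nH) →
    ∣ U ∣ ≡ k → IsClique H U →
    (fH : Fin nH → Fin nH) → Bijective _≡_ _≡_ fH →
    (∀ u → u ∈ U → toℕ (fH u) < k) →
    (X : CVert nG U → Bool) →
    Colourful nH (CColour fG U fH) X →
    Σ (Fin nH → Fin nH → Bool) λ D →
      (∀ a b → D a b ≡ D b a) ×
      (∀ a b → T (D a b) → a ∈ U × b ∈ U × T (adj H a b)) ×
      Σ (Σ (CVert nG U) (λ x → T (X x)) ⤖ Fin nH) (λ φ →
        (∀ x y → CAdj G fG H U fH (proj₁ x) (proj₁ y)
                 ⇔ T (adj H (Bijection.to φ x) (Bijection.to φ y)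
                      ∧ not (D (Bijection.to φ x) (Bijection.to φ y))))) ×
      countPairs nH D ≡ nonEdgesOnVG G U X
mainTheorem6 nG nH k G fG H U ∣U∣≡k U-clique fH fH-bijective fH[U]<k X X-colourful =
  deleted , deleted-sym , deleted⇒U-edge , (φ , φ-adjacency) , deletedCount
  where open ColourfulSubgraph G fG H U ∣U∣≡k U-clique fH fH-bijective fH[U]<k X X-colourful
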